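{- Let $M$ be a connected matroid with $\lambda(M)=\sigma(M)=k$ and $\mathrm{rank}(M)=r$, and let $C_1,\ldots,C_\ell$ be the minimum cocircuits of $M$. Then the crux $\chi(M)=M\setminus\bigcup_{i=1}^\ell C_i$ has rank $r-\ell$.
   Context: $\sigma(M)$ is the largest number of pairwise disjoint bases of $M$. A cocircuit is a minimal subset of the ground set meeting every base; $\lambda(M)$ (cogirth) is the smallest size of a cocircuit; a minimum cocircuit is a cocircuit of size $\lambda(M)$. $M\setminus X$ denotes the deletion of $X$; if $\bigcup_i C_i$ is the whole ground set the crux is the empty matroid, of rank $0$. -}

module Defs where

open import Data.Nat using (ℕ; zero; suc; _≤_; _<_; _+_)
open import Data.Fin using (Fin)
open import Data.Fin.Subset
  using (Subset; ⊥; ⊤; ⁅_⁆; _∈_; _∉_; _⊆_; _⊂_; ∁; _∩_; _∪_; ∣_∣; Nonempty; Empty)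
open import Data.Product using (Σ; ∃; ∃-syntax; _×_; _,_)
open import Relation.Nullary using (¬_)
open import Relation.Binary.PropositionalEquality using (_≡_; _≢_)

record Matroid (n : ℕ) : Set₁ where
  field
    Indep     : Subset n → Set
    indep-⊥   : Indep ⊥
    indep-⊆   : ∀ {I J} → J ⊆ I → Indep I → Indep J
    indep-aug : ∀ {I J} → Indep I → Indep J → ∣ I ∣ < ∣ J ∣ →
                ∃[ x ] (x ∈ J × x ∉ I × Indep (I ∪ ⁅ x ⁆))

module _ {n : ℕ} (M : Matroid n) where
  open Matroid M

  IsBase : Subset n → Set
  IsBase B = Indep B × (∀ J → Indep J → B ⊆ J → J ⊆ B)

  IsCircuit : Subset n → Set
  IsCircuit C = ¬ Indep C × (∀ D → D ⊂ C → Indep D)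

  Connected : Set
  Connected = ∀ (x y : Fin n) → x ≢ y → ∃[ C ] (IsCircuit C × x ∈ C × y ∈ C)

  MeetsAllBases : Subset n → Set
  MeetsAllBases X = ∀ B → IsBase B → Nonempty (X ∩ B)

  IsCocircuit : Subset n → Set
  IsCocircuit C = MeetsAllBases C × (∀ D → D ⊆ C → MeetsAllBases D → C ⊆ D)

  -- λ(M) = k : k is the smallest size of a cocircuit
  Cogirth : ℕ → Set
  Cogirth k = (∃[ C ] (IsCocircuit C × ∣ C ∣ ≡ k))
            × (∀ C → IsCocircuit C → k ≤ ∣ C ∣)

  DisjointBases : (m : ℕ) → (Fin m → Subset n) → Set
  DisjointBases m Bs = (∀ i → IsBase (Bs i))
                     × (∀ i j → i ≢ j → Empty (Bs i ∩ Bs j))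

  -- σ(M) = k : k is the largest number of pairwise disjoint bases
  BasePacking : ℕ → Set
  BasePacking k = (∃[ Bs ] DisjointBases k Bs)
                × (∀ m → k < m → ¬ (∃[ Bs ] DisjointBases m Bs))

  RankOf : Subset n → ℕ → Set
  RankOf X r = (∃[ I ] (I ⊆ X × Indep I × ∣ I ∣ ≡ r))
             × (∀ I → I ⊆ X → Indep I → ∣ I ∣ ≤ r)

  RankDeletion : Subset n → ℕ → Set
  RankDeletion X r = RankOf (∁ X) r

⋃ᶠ : ∀ {n ℓ} → (Fin ℓ → Subset n) → Subset n
⋃ᶠ {ℓ = zero}  Cs = ⊥
⋃ᶠ {ℓ = suc ℓ} Cs = Cs Fin.zero ∪ ⋃ᶠ (λ i → Cs (Fin.suc i))
  where import Data.Fin as Fin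

-- Fix k pairwise disjoint bases B₁,…,B_k. A cocircuit meets every base, so it
-- has at least k elements; a minimum cocircuit C therefore meets each Bⱼ in
-- exactly one element, since dropping a spare element would leave a smaller set
-- that still meets every base. Two distinct minimum cocircuits C₁, C₂ are
-- disjoint: for e ∈ C₁ ∩ C₂ in the base B, exchanging e for some y ∈ C₁ ∖ C₂
-- gives a base B − e + y avoiding C₂. Hence a packing base B meets
-- D = C₁ ∪ … ∪ C_ℓ in exactly ℓ elements, while every base meets D in at least
-- ℓ elements; so B − D has size r − ℓ and no independent subset of E − D is
-- larger.
module Submission where

open import Defs
open import Data.Nat using (ℕ; zero; suc; _+_; _∸_; _≤_; _<_; z≤n; s≤s)
open import Data.Nat.Properties
  using (≤-reflexive; ≤-trans; ≤-antisym; <⇒≱; ≮⇒≥; +-suc; +-comm; +-identityʳ;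
         +-mono-≤; +-cancelʳ-≤; m≤m+n; m≤n+m; m∸n+n≡m; module ≤-Reasoning)
open import Data.Fin using (Fin) renaming (zero to fzero; suc to fsuc)
open import Data.Fin.Properties using (any?; _≟_; suc-injective)
open import Data.Fin.Subset
  using (Subset; ⊤; ⊥; ⁅_⁆; _∈_; _∉_; _⊆_; _⊂_; ∁; _∩_; _∪_; ∣_∣; Nonempty; Empty;
         inside; outside)
open import Data.Fin.Subset.Properties
open import Data.Product using (∃-syntax; _×_; _,_; proj₁; proj₂)
open import Data.Sum using (inj₁; inj₂)
open import Data.Empty using (⊥-elim)
open import Data.Vec using ([]; _∷_)
open import Function using (_∘_)
open import Relation.Nullary using (¬_; yes; no)
open import Relation.Nullary.Negation using (contradiction)
open import Relation.Nullary.Decidable using (_×-dec_; ¬?)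
open import Relation.Binary.PropositionalEquality
  using (_≡_; _≢_; refl; sym; trans; cong; subst; module ≡-Reasoning)

PairwiseDisjoint : ∀ {n m} → (Fin m → Subset n) → Set
PairwiseDisjoint F = ∀ i j → i ≢ j → Empty (F i ∩ F j)

∣p∪q∣+∣p∩q∣≡∣p∣+∣q∣ : ∀ {n} (p q : Subset n) → ∣ p ∪ q ∣ + ∣ p ∩ q ∣ ≡ ∣ p ∣ + ∣ q ∣
∣p∪q∣+∣p∩q∣≡∣p∣+∣q∣ []            []            = refl
∣p∪q∣+∣p∩q∣≡∣p∣+∣q∣ (inside  ∷ p) (inside  ∷ q) =
  cong suc (trans (+-suc _ _) (trans (cong suc (∣p∪q∣+∣p∩q∣≡∣p∣+∣q∣ p q)) (sym (+-suc _ _))))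
∣p∪q∣+∣p∩q∣≡∣p∣+∣q∣ (inside  ∷ p) (outside ∷ q) = cong suc (∣p∪q∣+∣p∩q∣≡∣p∣+∣q∣ p q)
∣p∪q∣+∣p∩q∣≡∣p∣+∣q∣ (outside ∷ p) (inside  ∷ q) =
  trans (cong suc (∣p∪q∣+∣p∩q∣≡∣p∣+∣q∣ p q)) (sym (+-suc _ _))
∣p∪q∣+∣p∩q∣≡∣p∣+∣q∣ (outside ∷ p) (outside ∷ q) = ∣p∪q∣+∣p∩q∣≡∣p∣+∣q∣ p q

∣p∪q∣≤∣p∣+∣q∣ : ∀ {n} (p q : Subset n) → ∣ p ∪ q ∣ ≤ ∣ p ∣ + ∣ q ∣
∣p∪q∣≤∣p∣+∣q∣ p q = ≤-trans (m≤m+n _ _) (≤-reflexive (∣p∪q∣+∣p∩q∣≡∣p∣+∣q∣ p q))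

p∩q≡∅⇒∣p∪q∣≡∣p∣+∣q∣ : ∀ {n} {p q : Subset n} → Empty (p ∩ q) → ∣ p ∪ q ∣ ≡ ∣ p ∣ + ∣ q ∣
p∩q≡∅⇒∣p∪q∣≡∣p∣+∣q∣ {n} {p} {q} p∩q≡∅ = begin
  ∣ p ∪ q ∣             ≡⟨ +-identityʳ _ ⟨
  ∣ p ∪ q ∣ + 0         ≡⟨ cong (∣ p ∪ q ∣ +_) ∣p∩q∣≡0 ⟨
  ∣ p ∪ q ∣ + ∣ p ∩ q ∣ ≡⟨ ∣p∪q∣+∣p∩q∣≡∣p∣+∣q∣ p q ⟩
  ∣ p ∣ + ∣ q ∣         ∎
  where
  open ≡-Reasoning
  ∣p∩q∣≡0 : ∣ p ∩ q ∣ ≡ 0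
  ∣p∩q∣≡0 = trans (cong ∣_∣ (Empty-unique p∩q≡∅)) (∣⊥∣≡0 n)

x∉p⇒∣p∪⁅x⁆∣≡1+∣p∣ : ∀ {n} {p : Subset n} {x} → x ∉ p → ∣ p ∪ ⁅ x ⁆ ∣ ≡ suc ∣ p ∣
x∉p⇒∣p∪⁅x⁆∣≡1+∣p∣ {p = p} {x} x∉p = begin
  ∣ p ∪ ⁅ x ⁆ ∣     ≡⟨ p∩q≡∅⇒∣p∪q∣≡∣p∣+∣q∣ p∩⁅x⁆≡∅ ⟩
  ∣ p ∣ + ∣ ⁅ x ⁆ ∣ ≡⟨ cong (∣ p ∣ +_) (∣⁅x⁆∣≡1 x) ⟩
  ∣ p ∣ + 1         ≡⟨ +-comm ∣ p ∣ 1 ⟩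
  suc ∣ p ∣         ∎
  where
  open ≡-Reasoning
  p∩⁅x⁆≡∅ : Empty (p ∩ ⁅ x ⁆)
  p∩⁅x⁆≡∅ (y , y∈p∩⁅x⁆) with x∈p∩q⁻ p ⁅ x ⁆ y∈p∩⁅x⁆
  ... | y∈p , y∈⁅x⁆ = x∉p (subst (_∈ p) (x∈⁅y⁆⇒x≡y x y∈⁅x⁆) y∈p)

∣p∩q∣+∣p∩∁q∣≡∣p∣ : ∀ {n} (p q : Subset n) → ∣ p ∩ q ∣ + ∣ p ∩ ∁ q ∣ ≡ ∣ p ∣
∣p∩q∣+∣p∩∁q∣≡∣p∣ []            []            = refl
∣p∩q∣+∣p∩∁q∣≡∣p∣ (inside  ∷ p) (inside  ∷ q) = cong suc (∣p∩q∣+∣p∩∁q∣≡∣p∣ p q)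
∣p∩q∣+∣p∩∁q∣≡∣p∣ (inside  ∷ p) (outside ∷ q) = trans (+-suc _ _) (cong suc (∣p∩q∣+∣p∩∁q∣≡∣p∣ p q))
∣p∩q∣+∣p∩∁q∣≡∣p∣ (outside ∷ p) (inside  ∷ q) = ∣p∩q∣+∣p∩∁q∣≡∣p∣ p q
∣p∩q∣+∣p∩∁q∣≡∣p∣ (outside ∷ p) (outside ∷ q) = ∣p∩q∣+∣p∩∁q∣≡∣p∣ p q

x∈p⇒1+∣p∩∁⁅x⁆∣≡∣p∣ : ∀ {n} {p : Subset n} {x} → x ∈ p → suc ∣ p ∩ ∁ ⁅ x ⁆ ∣ ≡ ∣ p ∣
x∈p⇒1+∣p∩∁⁅x⁆∣≡∣p∣ {p = p} {x} x∈p = begin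
  suc ∣ p ∩ ∁ ⁅ x ⁆ ∣             ≡⟨ cong (_+ ∣ p ∩ ∁ ⁅ x ⁆ ∣) ∣p∩⁅x⁆∣≡1 ⟨
  ∣ p ∩ ⁅ x ⁆ ∣ + ∣ p ∩ ∁ ⁅ x ⁆ ∣ ≡⟨ ∣p∩q∣+∣p∩∁q∣≡∣p∣ p ⁅ x ⁆ ⟩
  ∣ p ∣                           ∎
  where
  open ≡-Reasoning
  ⁅x⁆⊆p∩⁅x⁆ : ⁅ x ⁆ ⊆ p ∩ ⁅ x ⁆
  ⁅x⁆⊆p∩⁅x⁆ y∈⁅x⁆ = x∈p∩q⁺ (subst (_∈ p) (sym (x∈⁅y⁆⇒x≡y x y∈⁅x⁆)) x∈p , y∈⁅x⁆)
  ∣p∩⁅x⁆∣≡1 : ∣ p ∩ ⁅ x ⁆ ∣ ≡ 1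
  ∣p∩⁅x⁆∣≡1 = trans (cong ∣_∣ (⊆-antisym (p∩q⊆q p ⁅ x ⁆) ⁅x⁆⊆p∩⁅x⁆)) (∣⁅x⁆∣≡1 x)

x∉p∩∁⁅x⁆ : ∀ {n} (p : Subset n) (x : Fin n) → x ∉ p ∩ ∁ ⁅ x ⁆
x∉p∩∁⁅x⁆ p x x∈ = x∈∁p⇒x∉p (proj₂ (x∈p∩q⁻ p _ x∈)) (x∈⁅x⁆ x)

x∈p∧x≢y⇒x∈p∩∁⁅y⁆ : ∀ {n} {p : Subset n} {x y} → x ∈ p → x ≢ y → x ∈ p ∩ ∁ ⁅ y ⁆
x∈p∧x≢y⇒x∈p∩∁⁅y⁆ x∈p x≢y = x∈p∩q⁺ (x∈p , x∉p⇒x∈∁p (x≢y⇒x∉⁅y⁆ x≢y))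

x∈p⇒p∩∁⁅x⁆⊂p : ∀ {n} {p : Subset n} {x} → x ∈ p → p ∩ ∁ ⁅ x ⁆ ⊂ p
x∈p⇒p∩∁⁅x⁆⊂p {p = p} {x} x∈p = p∩q⊆p p _ , x , x∈p , x∉p∩∁⁅x⁆ p x

p⊆q∧∣q∣≤∣p∣⇒q⊆p : ∀ {n} {p q : Subset n} → p ⊆ q → ∣ q ∣ ≤ ∣ p ∣ → q ⊆ p
p⊆q∧∣q∣≤∣p∣⇒q⊆p {p = p} p⊆q ∣q∣≤∣p∣ {x} x∈q with x ∈? p
... | yes x∈p = x∈p
... | no  x∉p = contradiction ∣q∣≤∣p∣ (<⇒≱ (p⊂q⇒∣p∣<∣q∣ (p⊆q , x , x∈q , x∉p)))

p⊈q⇒∃x∈p∖q : ∀ {n} {p q : Subset n} → ¬ p ⊆ q → ∃[ x ] (x ∈ p × x ∉ q)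
p⊈q⇒∃x∈p∖q {p = p} {q} p⊈q with any? (λ x → x ∈? p ×-dec ¬? (x ∈? q))
... | yes witness = witness
... | no  none    = ⊥-elim (p⊈q p⊆q)
  where
  p⊆q : p ⊆ q
  p⊆q {x} x∈p with x ∈? q
  ... | yes x∈q = x∈q
  ... | no  x∉q = contradiction (x , x∈p , x∉q) none

p∩q≡∅⇒p∩[q∪⁅x⁆]≡∅ : ∀ {n} {p q : Subset n} {x} → Empty (p ∩ q) → x ∉ p → Empty (p ∩ (q ∪ ⁅ x ⁆))
p∩q≡∅⇒p∩[q∪⁅x⁆]≡∅ {p = p} {q} {x} p∩q≡∅ x∉p (y , y∈) with x∈p∩q⁻ p _ y∈
... | y∈p , y∈q∪⁅x⁆ with x∈p∪q⁻ q ⁅ x ⁆ y∈q∪⁅x⁆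
...   | inj₁ y∈q   = p∩q≡∅ (y , x∈p∩q⁺ (y∈p , y∈q))
...   | inj₂ y∈⁅x⁆ = x∉p (subst (_∈ p) (x∈⁅y⁆⇒x≡y x y∈⁅x⁆) y∈p)

p∩q⊆⁅x⁆⇒q∩[p∩∁⁅x⁆]≡∅ : ∀ {n} {p q : Subset n} {x} → p ∩ q ⊆ ⁅ x ⁆ → Empty (q ∩ (p ∩ ∁ ⁅ x ⁆))
p∩q⊆⁅x⁆⇒q∩[p∩∁⁅x⁆]≡∅ {p = p} {q} {x} p∩q⊆⁅x⁆ (y , y∈) with x∈p∩q⁻ q _ y∈
... | y∈q , y∈p∖x with x∈p∩q⁻ p _ y∈p∖x
...   | y∈p , _ =
  x∉p∩∁⁅x⁆ p x (subst (_∈ p ∩ ∁ ⁅ x ⁆) (x∈⁅y⁆⇒x≡y x (p∩q⊆⁅x⁆ (x∈p∩q⁺ (y∈p , y∈q)))) y∈p∖x)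

-- Removing F 0 from X loses at least one element of X and no element of the other F i.
hits-disjoint⇒m≤∣X∣ : ∀ {n m} (F : Fin m → Subset n) → PairwiseDisjoint F →
                      (X : Subset n) → (∀ i → Nonempty (X ∩ F i)) → m ≤ ∣ X ∣
hits-disjoint⇒m≤∣X∣ {m = zero}  F _    X _    = z≤n
hits-disjoint⇒m≤∣X∣ {m = suc m} F disj X hits =
  ≤-trans (s≤s (hits-disjoint⇒m≤∣X∣ (F ∘ fsuc) disj′ X′ hits′)) (p⊂q⇒∣p∣<∣q∣ X′⊂X)
  where
  X′ = X ∩ ∁ (F fzero)
  X′⊂X : X′ ⊂ X
  X′⊂X with hits fzero
  ... | x , x∈X∩F₀ with x∈p∩q⁻ X _ x∈X∩F₀
  ...   | x∈X , x∈F₀ = p∩q⊆p X _ , x , x∈X , λ x∈X′ → x∈∁p⇒x∉p (proj₂ (x∈p∩q⁻ X _ x∈X′)) x∈F₀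
  disj′ : PairwiseDisjoint (F ∘ fsuc)
  disj′ i j i≢j = disj (fsuc i) (fsuc j) (i≢j ∘ suc-injective)
  hits′ : ∀ i → Nonempty (X′ ∩ F (fsuc i))
  hits′ i with hits (fsuc i)
  ... | y , y∈X∩Fᵢ with x∈p∩q⁻ X _ y∈X∩Fᵢ
  ...   | y∈X , y∈Fᵢ = y , x∈p∩q⁺ (x∈p∩q⁺ (y∈X , x∉p⇒x∈∁p y∉F₀) , y∈Fᵢ)
    where
    y∉F₀ : y ∉ F fzero
    y∉F₀ y∈F₀ = disj (fsuc i) fzero (λ ()) (y , x∈p∩q⁺ (y∈Fᵢ , y∈F₀))

x∈⋃ᶠ⁺ : ∀ {n ℓ} (F : Fin ℓ → Subset n) i {x} → x ∈ F i → x ∈ ⋃ᶠ F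
x∈⋃ᶠ⁺ F fzero    x∈F₀ = p⊆p∪q _ x∈F₀
x∈⋃ᶠ⁺ F (fsuc i) x∈Fᵢ = q⊆p∪q (F fzero) _ (x∈⋃ᶠ⁺ (F ∘ fsuc) i x∈Fᵢ)

∣p∩⋃ᶠF∣≤ℓ : ∀ {n ℓ} (p : Subset n) (F : Fin ℓ → Subset n) →
            (∀ i → ∣ p ∩ F i ∣ ≤ 1) → ∣ p ∩ ⋃ᶠ F ∣ ≤ ℓ
∣p∩⋃ᶠF∣≤ℓ {n} {zero}  p F _ = ≤-trans (∣p∩q∣≤∣q∣ p ⊥) (≤-reflexive (∣⊥∣≡0 n))
∣p∩⋃ᶠF∣≤ℓ {ℓ = suc ℓ} p F ≤1 = begin
  ∣ p ∩ (F fzero ∪ ⋃ᶠ (F ∘ fsuc)) ∣         ≡⟨ cong ∣_∣ (∩-distribˡ-∪ p _ _) ⟩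
  ∣ p ∩ F fzero ∪ p ∩ ⋃ᶠ (F ∘ fsuc) ∣       ≤⟨ ∣p∪q∣≤∣p∣+∣q∣ (p ∩ F fzero) _ ⟩
  ∣ p ∩ F fzero ∣ + ∣ p ∩ ⋃ᶠ (F ∘ fsuc) ∣   ≤⟨ +-mono-≤ (≤1 fzero) (∣p∩⋃ᶠF∣≤ℓ p (F ∘ fsuc) (≤1 ∘ fsuc)) ⟩
  suc ℓ                                     ∎
  where open ≤-Reasoning

ℓ≤∣p∩⋃ᶠF∣ : ∀ {n ℓ} (p : Subset n) (F : Fin ℓ → Subset n) → PairwiseDisjoint F →
            (∀ i → Nonempty (F i ∩ p)) → ℓ ≤ ∣ p ∩ ⋃ᶠ F ∣
ℓ≤∣p∩⋃ᶠF∣ p F disj meets = hits-disjoint⇒m≤∣X∣ F disj (p ∩ ⋃ᶠ F) hits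
  where
  hits : ∀ i → Nonempty ((p ∩ ⋃ᶠ F) ∩ F i)
  hits i with meets i
  ... | x , x∈Fᵢ∩p with x∈p∩q⁻ (F i) p x∈Fᵢ∩p
  ...   | x∈Fᵢ , x∈p = x , x∈p∩q⁺ (x∈p∩q⁺ (x∈p , x∈⋃ᶠ⁺ F i x∈Fᵢ) , x∈Fᵢ)

module MatroidProperties {n : ℕ} (M : Matroid n) where
  open Matroid M

  cocircuit-minimal : ∀ {C x} → IsCocircuit M C → x ∈ C → ¬ MeetsAllBases M (C ∩ ∁ ⁅ x ⁆)
  cocircuit-minimal {C} {x} (_ , minimal) x∈C meets =
    x∉p∩∁⁅x⁆ C x (minimal _ (p∩q⊆p C _) meets x∈C)

  module OfRank {r : ℕ} (rank : RankOf M ⊤ r) where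

    I₀ : Subset n
    I₀ = proj₁ (proj₁ rank)

    I₀-indep : Indep I₀
    I₀-indep = proj₁ (proj₂ (proj₂ (proj₁ rank)))

    ∣I₀∣≡r : ∣ I₀ ∣ ≡ r
    ∣I₀∣≡r = proj₂ (proj₂ (proj₂ (proj₁ rank)))

    indep⇒∣I∣≤r : ∀ {I} → Indep I → ∣ I ∣ ≤ r
    indep⇒∣I∣≤r = proj₂ rank _ (λ _ → ∈⊤)

    indep∧∣I∣≡r⇒base : ∀ {I} → Indep I → ∣ I ∣ ≡ r → IsBase M I
    indep∧∣I∣≡r⇒base I-indep ∣I∣≡r =
      I-indep , λ J J-indep I⊆J →
        p⊆q∧∣q∣≤∣p∣⇒q⊆p I⊆J (subst (∣ J ∣ ≤_) (sym ∣I∣≡r) (indep⇒∣I∣≤r J-indep))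

    augment : ∀ {I} → Indep I → ∣ I ∣ < r → ∃[ x ] (x ∉ I × Indep (I ∪ ⁅ x ⁆))
    augment I-indep ∣I∣<r with indep-aug I-indep I₀-indep (subst (_ <_) (sym ∣I₀∣≡r) ∣I∣<r)
    ... | x , _ , x∉I , I+x-indep = x , x∉I , I+x-indep

    ∣base∣≡r : ∀ {B} → IsBase M B → ∣ B ∣ ≡ r
    ∣base∣≡r {B} (B-indep , B-maximal) = ≤-antisym (indep⇒∣I∣≤r B-indep) (≮⇒≥ ∣B∣≮r)
      where
      ∣B∣≮r : ¬ ∣ B ∣ < r
      ∣B∣≮r ∣B∣<r with augment B-indep ∣B∣<r
      ... | x , x∉B , B+x-indep = x∉B (B-maximal _ B+x-indep (p⊆p∪q _) (q⊆p∪q B _ (x∈⁅x⁆ x)))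

    cocircuit-nonempty : ∀ {C} → IsCocircuit M C → Nonempty C
    cocircuit-nonempty (meets , _) with meets I₀ (indep∧∣I∣≡r⇒base I₀-indep ∣I₀∣≡r)
    ... | x , x∈C∩I₀ = x , proj₁ (x∈p∩q⁻ _ I₀ x∈C∩I₀)

    extend-to-base : ∀ {I} → Indep I → ∃[ B ] (IsBase M B × I ⊆ B)
    extend-to-base {I} I-indep = extend (r ∸ ∣ I ∣) I-indep (m∸n+n≡m (indep⇒∣I∣≤r I-indep))
      where
      extend : ∀ d {J} → Indep J → d + ∣ J ∣ ≡ r → ∃[ B ] (IsBase M B × J ⊆ B)
      extend zero    J-indep ∣J∣≡r = _ , indep∧∣I∣≡r⇒base J-indep ∣J∣≡r , ⊆-refl
      extend (suc d) {J} J-indep d+1+∣J∣≡r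
        with augment J-indep (subst (suc ∣ J ∣ ≤_) d+1+∣J∣≡r (s≤s (m≤n+m ∣ J ∣ d)))
      ... | x , x∉J , J+x-indep
        with extend d J+x-indep
               (trans (cong (d +_) (x∉p⇒∣p∪⁅x⁆∣≡1+∣p∣ x∉J)) (trans (+-suc d ∣ J ∣) d+1+∣J∣≡r))
      ...   | B , B-base , J+x⊆B = B , B-base , J+x⊆B ∘ p⊆p∪q _

    ∣B∩∁X∣+∣B∩X∣≡r : ∀ {B} → IsBase M B → ∀ X → ∣ B ∩ ∁ X ∣ + ∣ B ∩ X ∣ ≡ r
    ∣B∩∁X∣+∣B∩X∣≡r {B} B-base X =
      trans (+-comm ∣ B ∩ ∁ X ∣ _) (trans (∣p∩q∣+∣p∩∁q∣≡∣p∣ B X) (∣base∣≡r B-base))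

    indep-exchange⇒base : ∀ {B e y} → IsBase M B → e ∈ B → y ∉ B ∩ ∁ ⁅ e ⁆ →
                          Indep (B ∩ ∁ ⁅ e ⁆ ∪ ⁅ y ⁆) → IsBase M (B ∩ ∁ ⁅ e ⁆ ∪ ⁅ y ⁆)
    indep-exchange⇒base B-base e∈B y∉B-e B-e+y-indep =
      indep∧∣I∣≡r⇒base B-e+y-indep
        (trans (x∉p⇒∣p∪⁅x⁆∣≡1+∣p∣ y∉B-e) (trans (x∈p⇒1+∣p∩∁⁅x⁆∣≡∣p∣ e∈B) (∣base∣≡r B-base)))

    -- Were B − e + y dependent, augmenting B − e from any base B′ would add an
    -- element of C − y (otherwise it yields a base avoiding C), so C − y would
    -- still meet every base.
    cocircuit-exchange : ∀ {C B e y} → IsCocircuit M C → IsBase M B → e ∈ B →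
                         B ∩ C ⊆ ⁅ e ⁆ → y ∈ C → ¬ ¬ Indep (B ∩ ∁ ⁅ e ⁆ ∪ ⁅ y ⁆)
    cocircuit-exchange {C} {B} {y = y} C-cocircuit B-base e∈B B∩C⊆⁅e⁆ y∈C B-e+y-dependent =
      cocircuit-minimal C-cocircuit y∈C C-y-meets
      where
      C-y-meets : MeetsAllBases M (C ∩ ∁ ⁅ y ⁆)
      C-y-meets B′ B′-base with nonempty? ((C ∩ ∁ ⁅ y ⁆) ∩ B′)
      ... | yes hit  = hit
      ... | no  miss
        with indep-aug (indep-⊆ (p∩q⊆p B _) (proj₁ B-base)) (proj₁ B′-base)
               (≤-reflexive (trans (x∈p⇒1+∣p∩∁⁅x⁆∣≡∣p∣ e∈B)
                                   (trans (∣base∣≡r B-base) (sym (∣base∣≡r B′-base)))))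
      ...   | w , w∈B′ , w∉B-e , B-e+w-indep with w ≟ y
      ...     | yes refl = contradiction B-e+w-indep B-e+y-dependent
      ...     | no  w≢y  = ⊥-elim
        (p∩q≡∅⇒p∩[q∪⁅x⁆]≡∅ (p∩q⊆⁅x⁆⇒q∩[p∩∁⁅x⁆]≡∅ B∩C⊆⁅e⁆) w∉C
          (proj₁ C-cocircuit _ (indep-exchange⇒base B-base e∈B w∉B-e B-e+w-indep)))
        where
        w∉C : w ∉ C
        w∉C w∈C = miss (w , x∈p∩q⁺ (x∈p∧x≢y⇒x∈p∩∁⁅y⁆ w∈C w≢y , w∈B′))

    rank-deletion-⋃ᶠ : ∀ {ℓ B} (Cs : Fin ℓ → Subset n) → PairwiseDisjoint Cs →
                       (∀ i → MeetsAllBases M (Cs i)) → IsBase M B → (∀ i → ∣ B ∩ Cs i ∣ ≤ 1) →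
                       ∃[ s ] (RankDeletion M (⋃ᶠ Cs) s × s + ℓ ≡ r)
    rank-deletion-⋃ᶠ {ℓ} {B} Cs disjoint meets B-base ∣B∩Cᵢ∣≤1 =
      ∣ B ∩ ∁ D ∣ , (B-D-witness , maximal) , s+ℓ≡r
      where
      D = ⋃ᶠ Cs
      ℓ≤∣base∩D∣ : ∀ {B′} → IsBase M B′ → ℓ ≤ ∣ B′ ∩ D ∣
      ℓ≤∣base∩D∣ B′-base = ℓ≤∣p∩⋃ᶠF∣ _ Cs disjoint (λ i → meets i _ B′-base)
      ∣B∩D∣≡ℓ : ∣ B ∩ D ∣ ≡ ℓ
      ∣B∩D∣≡ℓ = ≤-antisym (∣p∩⋃ᶠF∣≤ℓ B Cs ∣B∩Cᵢ∣≤1) (ℓ≤∣base∩D∣ B-base)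
      s+ℓ≡r : ∣ B ∩ ∁ D ∣ + ℓ ≡ r
      s+ℓ≡r = trans (cong (∣ B ∩ ∁ D ∣ +_) (sym ∣B∩D∣≡ℓ)) (∣B∩∁X∣+∣B∩X∣≡r B-base D)
      B-D-witness : ∃[ I ] (I ⊆ ∁ D × Indep I × ∣ I ∣ ≡ ∣ B ∩ ∁ D ∣)
      B-D-witness = B ∩ ∁ D , p∩q⊆q B _ , indep-⊆ (p∩q⊆p B _) (proj₁ B-base) , refl
      maximal : ∀ I → I ⊆ ∁ D → Indep I → ∣ I ∣ ≤ ∣ B ∩ ∁ D ∣
      maximal I I⊆∁D I-indep with extend-to-base I-indep
      ... | B′ , B′-base , I⊆B′ = +-cancelʳ-≤ ℓ ∣ I ∣ ∣ B ∩ ∁ D ∣ (begin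
        ∣ I ∣ + ℓ                      ≤⟨ +-mono-≤ (p⊆q⇒∣p∣≤∣q∣ I⊆B′∩∁D) (ℓ≤∣base∩D∣ B′-base) ⟩
        ∣ B′ ∩ ∁ D ∣ + ∣ B′ ∩ D ∣      ≡⟨ ∣B∩∁X∣+∣B∩X∣≡r B′-base D ⟩
        r                              ≡⟨ s+ℓ≡r ⟨
        ∣ B ∩ ∁ D ∣ + ℓ                ∎)
        where
        open ≤-Reasoning
        I⊆B′∩∁D : I ⊆ B′ ∩ ∁ D
        I⊆B′∩∁D x∈I = x∈p∩q⁺ (I⊆B′ x∈I , I⊆∁D x∈I)

  module Packing {k : ℕ} {Bs : Fin k → Subset n} (packing : DisjointBases M k Bs) where

    proper-subset-misses-a-base : ∀ {C Y} → ∣ C ∣ ≡ k → Y ⊂ C → ¬ (∀ j → Nonempty (Y ∩ Bs j))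
    proper-subset-misses-a-base {Y = Y} ∣C∣≡k Y⊂C hits =
      <⇒≱ (p⊂q⇒∣p∣<∣q∣ Y⊂C) (subst (_≤ ∣ Y ∣) (sym ∣C∣≡k) (hits-disjoint⇒m≤∣X∣ Bs (proj₂ packing) Y hits))

    meets-packing : ∀ {C} → IsCocircuit M C → ∀ j → ∃[ x ] (x ∈ C × x ∈ Bs j)
    meets-packing C-cocircuit j with proj₁ C-cocircuit (Bs j) (proj₁ packing j)
    ... | x , x∈C∩Bⱼ = x , x∈p∩q⁻ _ (Bs j) x∈C∩Bⱼ

    minimum-cocircuit-covered : ∀ {C x} → IsCocircuit M C → ∣ C ∣ ≡ k → x ∈ C → ∃[ j ] x ∈ Bs j
    minimum-cocircuit-covered {C} {x} C-cocircuit ∣C∣≡k x∈C with any? (λ j → x ∈? Bs j)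
    ... | yes covered   = covered
    ... | no  uncovered =
      contradiction hits (proper-subset-misses-a-base ∣C∣≡k (x∈p⇒p∩∁⁅x⁆⊂p x∈C))
      where
      hits : ∀ j → Nonempty ((C ∩ ∁ ⁅ x ⁆) ∩ Bs j)
      hits j with meets-packing C-cocircuit j
      ... | c , c∈C , c∈Bⱼ =
        c , x∈p∩q⁺ (x∈p∧x≢y⇒x∈p∩∁⁅y⁆ c∈C (λ { refl → uncovered (j , c∈Bⱼ) }) , c∈Bⱼ)

    minimum-cocircuit-∩-base⊆⁅x⁆ : ∀ {C x j} → IsCocircuit M C → ∣ C ∣ ≡ k →
                                   x ∈ C → x ∈ Bs j → Bs j ∩ C ⊆ ⁅ x ⁆
    minimum-cocircuit-∩-base⊆⁅x⁆ {C} {x} {j} C-cocircuit ∣C∣≡k x∈C x∈Bⱼ {y} y∈Bⱼ∩C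
      with x∈p∩q⁻ (Bs j) C y∈Bⱼ∩C
    ... | y∈Bⱼ , y∈C with y ≟ x
    ...   | yes refl = x∈⁅x⁆ x
    ...   | no  y≢x  = contradiction hits (proper-subset-misses-a-base ∣C∣≡k (x∈p⇒p∩∁⁅x⁆⊂p x∈C))
      where
      hits : ∀ j′ → Nonempty ((C ∩ ∁ ⁅ x ⁆) ∩ Bs j′)
      hits j′ with j′ ≟ j
      ... | yes refl = y , x∈p∩q⁺ (x∈p∧x≢y⇒x∈p∩∁⁅y⁆ y∈C y≢x , y∈Bⱼ)
      ... | no  j′≢j with meets-packing C-cocircuit j′
      ...   | c , c∈C , c∈Bⱼ′ = c , x∈p∩q⁺ (x∈p∧x≢y⇒x∈p∩∁⁅y⁆ c∈C c≢x , c∈Bⱼ′)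
        where
        c≢x : c ≢ x
        c≢x refl = proj₂ packing j′ j j′≢j (c , x∈p∩q⁺ (c∈Bⱼ′ , x∈Bⱼ))

    ∣base∩minimum-cocircuit∣≤1 : ∀ {C} → IsCocircuit M C → ∣ C ∣ ≡ k → ∀ j → ∣ Bs j ∩ C ∣ ≤ 1
    ∣base∩minimum-cocircuit∣≤1 C-cocircuit ∣C∣≡k j with meets-packing C-cocircuit j
    ... | x , x∈C , x∈Bⱼ =
      ≤-trans (p⊆q⇒∣p∣≤∣q∣ (minimum-cocircuit-∩-base⊆⁅x⁆ C-cocircuit ∣C∣≡k x∈C x∈Bⱼ))
              (≤-reflexive (∣⁅x⁆∣≡1 x))

  module _ {r : ℕ} (rank : RankOf M ⊤ r) {k : ℕ} {Bs : Fin k → Subset n}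
           (packing : DisjointBases M k Bs) where
    open OfRank rank
    open Packing packing

    minimum-cocircuits-disjoint : ∀ {C₁ C₂} → IsCocircuit M C₁ → ∣ C₁ ∣ ≡ k →
                                  IsCocircuit M C₂ → ∣ C₂ ∣ ≡ k → C₁ ≢ C₂ → Empty (C₁ ∩ C₂)
    minimum-cocircuits-disjoint {C₁} {C₂} C₁-cocircuit ∣C₁∣≡k C₂-cocircuit ∣C₂∣≡k C₁≢C₂
                                (e , e∈C₁∩C₂) with x∈p∩q⁻ C₁ C₂ e∈C₁∩C₂
    ... | e∈C₁ , e∈C₂ with minimum-cocircuit-covered C₁-cocircuit ∣C₁∣≡k e∈C₁
    ...   | t , e∈B with p⊈q⇒∃x∈p∖q C₁⊈C₂
      where
      C₁⊈C₂ : ¬ C₁ ⊆ C₂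
      C₁⊈C₂ C₁⊆C₂ = C₁≢C₂ (⊆-antisym C₁⊆C₂ (proj₂ C₂-cocircuit C₁ C₁⊆C₂ (proj₁ C₁-cocircuit)))
    ...     | y , y∈C₁ , y∉C₂ =
      cocircuit-exchange C₁-cocircuit B-base e∈B B∩C₁⊆⁅e⁆ y∈C₁ B-e+y-dependent
      where
      B-base = proj₁ packing t
      B∩C₁⊆⁅e⁆ = minimum-cocircuit-∩-base⊆⁅x⁆ C₁-cocircuit ∣C₁∣≡k e∈C₁ e∈B
      B∩C₂⊆⁅e⁆ = minimum-cocircuit-∩-base⊆⁅x⁆ C₂-cocircuit ∣C₂∣≡k e∈C₂ e∈B
      y∉B-e : y ∉ Bs t ∩ ∁ ⁅ e ⁆
      y∉B-e y∈B-e = p∩q⊆⁅x⁆⇒q∩[p∩∁⁅x⁆]≡∅ B∩C₁⊆⁅e⁆ (y , x∈p∩q⁺ (y∈C₁ , y∈B-e))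
      B-e+y-dependent : ¬ Indep (Bs t ∩ ∁ ⁅ e ⁆ ∪ ⁅ y ⁆)
      B-e+y-dependent B-e+y-indep =
        p∩q≡∅⇒p∩[q∪⁅x⁆]≡∅ (p∩q⊆⁅x⁆⇒q∩[p∩∁⁅x⁆]≡∅ B∩C₂⊆⁅e⁆) y∉C₂
          (proj₁ C₂-cocircuit _ (indep-exchange⇒base B-base e∈B y∉B-e B-e+y-indep))

lemma3p4 : ∀ {n : ℕ} (M : Matroid n) (k r ℓ : ℕ) (Cs : Fin ℓ → Subset n)
    → Connected M
    → Cogirth M k
    → BasePacking M k
    → RankOf M ⊤ r
    → (∀ i → IsCocircuit M (Cs i) × ∣ Cs i ∣ ≡ k)
    → (∀ i j → i ≢ j → Cs i ≢ Cs j)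
    → (∀ C → IsCocircuit M C → ∣ C ∣ ≡ k → ∃[ i ] (Cs i ≡ C))
    → ∃[ s ] (RankDeletion M (⋃ᶠ Cs) s × s + ℓ ≡ r)
lemma3p4 M k r ℓ Cs _ ((C₀ , C₀-cocircuit , ∣C₀∣≡k) , _) ((Bs , packing) , _) rank minimum distinct _ =
  rank-deletion-⋃ᶠ Cs Cs-disjoint (λ i → proj₁ (proj₁ (minimum i))) (proj₁ packing j)
    (λ i → ∣base∩minimum-cocircuit∣≤1 (proj₁ (minimum i)) (proj₂ (minimum i)) j)
  where
  open MatroidProperties M
  open OfRank rank
  open Packing packing
  Cs-disjoint : PairwiseDisjoint Cs
  Cs-disjoint i j i≢j =
    minimum-cocircuits-disjoint rank packing (proj₁ (minimum i)) (proj₂ (minimum i))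
      (proj₁ (minimum j)) (proj₂ (minimum j)) (distinct i j i≢j)
  -- A packing base exists because k ≥ 1: the minimum cocircuit C₀ is nonempty.
  j : Fin k
  j = proj₁ (minimum-cocircuit-covered C₀-cocircuit ∣C₀∣≡k (proj₂ (cocircuit-nonempty C₀-cocircuit)))
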